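{- For every integer $n\geq 1$, $\mathrm{thin}(K_n\,\square\,K_n)=n$.
   Context: Graphs are finite, simple, undirected; $K_n$ is the complete graph on $n$ vertices. The Cartesian product $G_1\,\square\,G_2$ has vertex set $V_1\times V_2$, and $(u_1,u_2)$, $(v_1,v_2)$ are adjacent iff either $u_1=v_1$ and $u_2v_2\in E_2$, or $u_2=v_2$ and $u_1v_1\in E_1$. For a graph $G=(V,E)$, an ordering $v_1,\dots,v_n$ of $V$ and a partition of $V$ are consistent if for every $r<s<t$, whenever $v_r,v_s$ are in the same class and $v_tv_r\in E$, then $v_tv_s\in E$. $\mathrm{thin}(G)$ is the minimum number of classes of a partition of $V$ consistent with some ordering of $V$. -}

module Defs where

open import Data.Nat using (ℕ; _*_; _≤_; _<_)
open import Data.Fin using (Fin)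
open import Data.Product using (_×_; _,_; proj₁; proj₂; ∃-syntax)
open import Data.Sum using (_⊎_)
open import Relation.Binary.PropositionalEquality using (_≡_; _≢_)
open import Function.Bundles using (_⤖_; Bijection)

-- A graph is given by its vertex type V and an adjacency relation Adj on V
-- (for the graphs used here: symmetric and irreflexive, i.e. simple undirected).

K-Adj : (n : ℕ) → Fin n → Fin n → Set
K-Adj n u v = u ≢ v

□-Adj : {V₁ V₂ : Set} → (V₁ → V₁ → Set) → (V₂ → V₂ → Set) → V₁ × V₂ → V₁ × V₂ → Set
□-Adj E₁ E₂ (u₁ , u₂) (v₁ , v₂) = (u₁ ≡ v₁ × E₂ u₂ v₂) ⊎ (u₂ ≡ v₂ × E₁ u₁ v₁)

-- An ordering of a vertex set V with N elements is a bijection Fin N ⤖ V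
-- (position i ↦ vertex v_i).  A partition into (at most) k classes is a map
-- V → Fin k (class labels; empty classes allowed, which does not change the
-- minimum).
Consistent : {V : Set} {N k : ℕ} → (V → V → Set) → (Fin N ⤖ V) → (V → Fin k) → Set
Consistent {V} {N} {k} E ord c =
  ∀ (r s t : Fin N) → r Data.Fin.< s → s Data.Fin.< t →
    c (f r) ≡ c (f s) → E (f t) (f r) → E (f t) (f s)
  where f = Bijection.to ord

ThinAtMost : {V : Set} (N : ℕ) → (V → V → Set) → ℕ → Set
ThinAtMost {V} N E k = ∃[ ord ] ∃[ c ] Consistent {V} {N} {k} E ord c

ThinEq : {V : Set} (N : ℕ) → (V → V → Set) → ℕ → Set
ThinEq {V} N E m = ThinAtMost {V} N E m × (∀ k → ThinAtMost {V} N E k → m ≤ k)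

module Submission where

-- List the cells of K_m □ K_n row by row and put each cell in
-- the class of its column.  If r < s < t with r, s in the same column and
-- t ~ r, then t cannot share the row of r (the row of s would be squeezed in
-- between, forcing s = r), so t shares the column of r, hence of s, and lies
-- in a different row from s: t ~ s.
--
-- Two vertices x, s
-- lie in different classes as soon as they are "separated": some w after s
-- sees x but not s, and some t after x sees s but not x (whichever of x, s
-- comes first, consistency is violated).  In an l × l subgrid let the corner
-- be its last cell in the ordering; of the first cell of the corner's row and
-- the first cell of the corner's column, the earlier one is separated from
-- every cell avoiding both lines.  Removing the corner's row and column and
-- recursing yields l cells of pairwise different classes (a rainbow set),
-- so every consistent partition of K_m □ K_n has at least min(m, n) classes.

open import Defs
open import Data.Nat using (ℕ; _*_; _≤_)
open import Data.Product using (_×_)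
open import Data.Fin using (Fin)

open import Data.Nat using (suc; _≤?_)
import Data.Nat.Properties as ℕ
open import Data.Fin using (zero; suc; toℕ; punchIn; combine; quotient; remainder)
import Data.Fin as F
import Data.Fin.Properties as FP
open import Data.Product using (Σ; _,_; proj₁; proj₂)
open import Data.Sum using (inj₁; inj₂)
open import Data.Empty using (⊥-elim)
open import Relation.Nullary using (¬_; yes; no)
open import Relation.Binary.Definitions using (tri<; tri≈; tri>)
open import Relation.Binary.PropositionalEquality
open import Function.Base using (_∘_)
open import Function.Bundles using (_⤖_; Bijection; Surjection)
open import Function.Definitions using (Injective)
open import Function.Properties.Inverse using (↔⇒⤖)

Rook : (m n : ℕ) → Fin m × Fin n → Fin m × Fin n → Set
Rook m n = □-Adj (K-Adj m) (K-Adj n)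

rook-nonadjacent : ∀ {m n} {u u′ : Fin m} {v v′ : Fin n} →
                   u ≢ u′ → v ≢ v′ → ¬ Rook m n (u , v) (u′ , v′)
rook-nonadjacent u≢u′ _    (inj₁ (u≡u′ , _)) = u≢u′ u≡u′
rook-nonadjacent _    v≢v′ (inj₂ (v≡v′ , _)) = v≢v′ v≡v′

module RowMajor (m n : ℕ) where

  rowMajor : Fin (m * n) ⤖ (Fin m × Fin n)
  rowMajor = ↔⇒⤖ (FP.*↔× {m} {n})

  row : Fin (m * n) → Fin m
  row = quotient n

  col : Fin (m * n) → Fin n
  col = remainder {m} n

  cell-injective : ∀ {r s} → row r ≡ row s → col r ≡ col s → r ≡ s
  cell-injective {r} {s} row≡ col≡ = begin
    r                       ≡⟨ FP.combine-remQuot {m} n r ⟨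
    combine (row r) (col r) ≡⟨ cong₂ combine row≡ col≡ ⟩
    combine (row s) (col s) ≡⟨ FP.combine-remQuot {m} n s ⟩
    s                       ∎
    where open ≡-Reasoning

  row-mono : ∀ {r s} → r F.< s → row r F.≤ row s
  row-mono {r} {s} r<s with toℕ (row r) ≤? toℕ (row s)
  ... | yes row≤ = row≤
  ... | no  row≰ = ⊥-elim (ℕ.<-asym r<s s<r)
    where
      s<r : s F.< r
      s<r = subst₂ F._<_ (FP.combine-remQuot {m} n s) (FP.combine-remQuot {m} n r)
                   (FP.combine-monoˡ-< (col s) (col r) (ℕ.≰⇒> row≰))

  -- Between two cells of one row only cells of that row occur; so the
  -- neighbour t of r must share r's column, which is also s's column.
  rowMajor-consistent : Consistent (Rook m n) rowMajor proj₂
  rowMajor-consistent r s t r<s s<t col≡ (inj₁ (rowt≡rowr , _)) =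
    ⊥-elim (FP.<-irrefl (cell-injective rowr≡rows col≡) r<s)
    where
      rowr≡rows : row r ≡ row s
      rowr≡rows = FP.≤-antisym (row-mono r<s) (subst (row s F.≤_) rowt≡rowr (row-mono s<t))
  rowMajor-consistent r s t r<s s<t col≡ (inj₂ (colt≡colr , _)) =
    inj₂ (colt≡cols , λ rowt≡rows → FP.<-irrefl (sym (cell-injective rowt≡rows colt≡cols)) s<t)
    where
      colt≡cols : col t ≡ col s
      colt≡cols = trans colt≡colr col≡

thin-upper : (m n : ℕ) → ThinAtMost (m * n) (Rook m n) n
thin-upper m n = rowMajor , proj₂ , rowMajor-consistent
  where open RowMajor m n

module Consistency {V : Set} {N k : ℕ} (E : V → V → Set) (ord : Fin N ⤖ V)
                   (c : V → Fin k) (consistent : Consistent E ord c) where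

  open Surjection (Bijection.surjection ord) using (to; to⁻; to∘to⁻)

  _≺_ : V → V → Set
  u ≺ v = to⁻ u F.< to⁻ v

  _≼_ : V → V → Set
  u ≼ v = to⁻ u F.≤ to⁻ v

  ≼∧≢⇒≺ : ∀ {u v} → u ≼ v → u ≢ v → u ≺ v
  ≼∧≢⇒≺ {u} {v} u≼v u≢v = ℕ.≤∧≢⇒< u≼v λ same → u≢v (begin
    u            ≡⟨ to∘to⁻ u ⟨
    to (to⁻ u)   ≡⟨ cong to (FP.toℕ-injective same) ⟩
    to (to⁻ v)   ≡⟨ to∘to⁻ v ⟩
    v            ∎)
    where open ≡-Reasoning

  conflict : ∀ {x y w} → x ≺ y → y ≺ w → E w x → ¬ E w y → c x ≢ c y
  conflict {x} {y} {w} x≺y y≺w wx ¬wy cx≡cy =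
    ¬wy (subst₂ E (to∘to⁻ w) (to∘to⁻ y)
          (consistent (to⁻ x) (to⁻ y) (to⁻ w) x≺y y≺w
            (subst₂ (λ a b → c a ≡ c b) (sym (to∘to⁻ x)) (sym (to∘to⁻ y)) cx≡cy)
            (subst₂ E (sym (to∘to⁻ w)) (sym (to∘to⁻ x)) wx)))

  -- Separated vertices lie in different classes: w after s sees x but not s,
  -- and t after x sees s but not x.  Whichever of x, s comes first, one of
  -- the two witnesses violates consistency.
  separated : ∀ {x s w t} → s ≺ w → E w x → ¬ E w s →
              x ≺ t → E t s → ¬ E t x → c x ≢ c s
  separated {x} {s} s≺w wx ¬ws x≺t ts ¬tx with FP.<-cmp (to⁻ x) (to⁻ s)
  ... | tri< x≺s _ _ = conflict x≺s s≺w wx ¬ws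
  ... | tri> _ _ s≺x = conflict s≺x x≺t ts ¬tx ∘ sym
  ... | tri≈ _ pos≡ _ = ⊥-elim (¬ws (subst (E _) x≡s wx))
    where
      x≡s : x ≡ s
      x≡s = trans (sym (to∘to⁻ x)) (trans (cong to pos≡) (to∘to⁻ s))

argmin : ∀ {l} (h : Fin (suc l) → ℕ) → Σ (Fin (suc l)) λ a → ∀ i → h a ≤ h i
argmin {ℕ.zero} h = zero , λ { zero → ℕ.≤-refl }
argmin {suc l}  h with argmin (h ∘ suc)
... | a , min with h zero ≤? h (suc a)
...   | yes h0≤ = zero  , λ { zero → ℕ.≤-refl ; (suc i) → ℕ.≤-trans h0≤ (min i) }
...   | no  h0≰ = suc a , λ { zero → ℕ.<⇒≤ (ℕ.≰⇒> h0≰) ; (suc i) → min i }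

argmax : ∀ {l} (h : Fin (suc l) → ℕ) → Σ (Fin (suc l)) λ a → ∀ i → h i ≤ h a
argmax {ℕ.zero} h = zero , λ { zero → ℕ.≤-refl }
argmax {suc l}  h with argmax (h ∘ suc)
... | a , max with h zero ≤? h (suc a)
...   | yes h0≤ = suc a , λ { zero → h0≤ ; (suc i) → max i }
...   | no  h0≰ = zero  , λ { zero → ℕ.≤-refl ; (suc i) → ℕ.≤-trans (max i) (ℕ.<⇒≤ (ℕ.≰⇒> h0≰)) }

argmax₂ : ∀ {l} (h : Fin (suc l) → Fin (suc l) → ℕ) →
          Σ (Fin (suc l)) λ a → Σ (Fin (suc l)) λ b → ∀ i j → h i j ≤ h a b
argmax₂ h with argmax (λ i → h i (proj₁ (argmax (h i))))
... | a , max = a , proj₁ (argmax (h a)) ,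
                λ i j → ℕ.≤-trans (proj₂ (argmax (h i)) j) (max i)

module LowerBound {m n N k : ℕ} (ord : Fin N ⤖ (Fin m × Fin n))
               (c : Fin m × Fin n → Fin k) (consistent : Consistent (Rook m n) ord c) where

  open Consistency (Rook m n) ord c consistent
  open Surjection (Bijection.surjection ord) using (to⁻)

  cell : ∀ {l} (α : Fin l → Fin m) (β : Fin l → Fin n) → Fin l × Fin l → Fin m × Fin n
  cell α β (i , j) = α i , β j

  Rainbow : ∀ {l} → (Fin l → Fin m) → (Fin l → Fin n) → Set
  Rainbow {l} α β = Σ (Fin l → Fin l × Fin l) λ g → Injective _≡_ _≡_ (c ∘ cell α β ∘ g)

  LastCell : ∀ {l} → (Fin l → Fin m) → (Fin l → Fin n) → Set
  LastCell {l} α β = Σ (Fin l) λ a → Σ (Fin l) λ b → ∀ i j → (α i , β j) ≼ (α a , β b)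

  lastCell : ∀ {l} (α : Fin (suc l) → Fin m) (β : Fin (suc l) → Fin n) → LastCell α β
  lastCell α β = argmax₂ (λ i j → toℕ (to⁻ (α i , β j)))

  -- One step of the recursion: in the subgrid (α, β) with corner (a , b)
  -- last in the ordering, some cell of row a or column b is in a class
  -- different from that of every cell outside row a and column b.
  -- (The subgrid has at least two rows, so the cross is not just the corner.)
  module Cross {l} (α : Fin (suc (suc l)) → Fin m) (β : Fin (suc (suc l)) → Fin n)
               (α-inj : Injective _≡_ _≡_ α) (β-inj : Injective _≡_ _≡_ β)
               (corner : LastCell α β) where

    a b : Fin (suc (suc l))
    a = proj₁ corner
    b = proj₁ (proj₂ corner)

    corner-last : ∀ i j → (α i , β j) ≼ (α a , β b)
    corner-last = proj₂ (proj₂ corner)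

    row : Fin (suc l) → Fin m
    row p = α (punchIn a p)

    col : Fin (suc l) → Fin n
    col q = β (punchIn b q)

    row≢ : ∀ p → row p ≢ α a
    row≢ p = FP.punchInᵢ≢i a p ∘ α-inj

    col≢ : ∀ q → col q ≢ β b
    col≢ q = FP.punchInᵢ≢i b q ∘ β-inj

    inner≺corner : ∀ p q → (row p , col q) ≺ (α a , β b)
    inner≺corner p q = ≼∧≢⇒≺ (corner-last (punchIn a p) (punchIn b q)) (row≢ p ∘ cong proj₁)

    -- If a cell x of the corner's row (off column b) precedes every other
    -- cell of the corner's column, then x is separated from every inner
    -- cell s = (row p , col q), witnessed by the corner and by (row p , β b).
    rowWitness : ∀ j → (∀ i → (α a , col j) ≼ (row i , β b)) →
                 ∀ p q → c (α a , col j) ≢ c (row p , col q)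
    rowWitness j first p q =
      separated (inner≺corner p q)
                (inj₁ (refl , col≢ j ∘ sym))
                (rook-nonadjacent (row≢ p ∘ sym) (col≢ q ∘ sym))
                (≼∧≢⇒≺ (first p) (row≢ p ∘ sym ∘ cong proj₁))
                (inj₁ (refl , col≢ q ∘ sym))
                (rook-nonadjacent (row≢ p) (col≢ j ∘ sym))

    colWitness : ∀ i → (∀ j → (row i , β b) ≼ (α a , col j)) →
                 ∀ p q → c (row i , β b) ≢ c (row p , col q)
    colWitness i first p q =
      separated (inner≺corner p q)
                (inj₂ (refl , row≢ i ∘ sym))
                (rook-nonadjacent (row≢ p ∘ sym) (col≢ q ∘ sym))
                (≼∧≢⇒≺ (first q) (col≢ q ∘ sym ∘ cong proj₂))
                (inj₂ (refl , row≢ p ∘ sym))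
                (rook-nonadjacent (row≢ i ∘ sym) (col≢ q))

    -- The earlier of the two first cells serves as the witness.
    crossWitness : Σ (Fin (suc (suc l)) × Fin (suc (suc l))) λ x →
                   ∀ p q → c (cell α β x) ≢ c (row p , col q)
    crossWitness with argmin (λ j → toℕ (to⁻ (α a , col j)))
                    | argmin (λ i → toℕ (to⁻ (row i , β b)))
    ... | j , rowFirst | i , colFirst with toℕ (to⁻ (α a , col j)) ≤? toℕ (to⁻ (row i , β b))
    ...   | yes row≼col = (a , punchIn b j) , rowWitness j (λ i′ → ℕ.≤-trans row≼col (colFirst i′))
    ...   | no  row⋠col = (punchIn a i , b) ,
                          colWitness i (λ j′ → ℕ.≤-trans (ℕ.<⇒≤ (ℕ.≰⇒> row⋠col)) (rowFirst j′))

    row-inj : Injective _≡_ _≡_ row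
    row-inj = FP.punchIn-injective a _ _ ∘ α-inj

    col-inj : Injective _≡_ _≡_ col
    col-inj = FP.punchIn-injective b _ _ ∘ β-inj

    extend : Rainbow row col → Rainbow α β
    extend (g′ , g′-rainbow) = g , g-rainbow
      where
        x : Fin (suc (suc l)) × Fin (suc (suc l))
        x = proj₁ crossWitness

        fresh : ∀ p q → c (cell α β x) ≢ c (row p , col q)
        fresh = proj₂ crossWitness

        g : Fin (suc (suc l)) → Fin (suc (suc l)) × Fin (suc (suc l))
        g zero    = x
        g (suc i) = punchIn a (proj₁ (g′ i)) , punchIn b (proj₂ (g′ i))

        g-rainbow : Injective _≡_ _≡_ (c ∘ cell α β ∘ g)
        g-rainbow {zero}  {zero}  _ = refl
        g-rainbow {zero}  {suc j} e = ⊥-elim (fresh (proj₁ (g′ j)) (proj₂ (g′ j)) e)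
        g-rainbow {suc i} {zero}  e = ⊥-elim (fresh (proj₁ (g′ i)) (proj₂ (g′ i)) (sym e))
        g-rainbow {suc i} {suc j} e = cong suc (g′-rainbow e)

  rainbow : ∀ l (α : Fin l → Fin m) (β : Fin l → Fin n) →
            Injective _≡_ _≡_ α → Injective _≡_ _≡_ β → Rainbow α β
  rainbow ℕ.zero        α β _ _ = (λ ()) , λ { {()} }
  rainbow (suc ℕ.zero)  α β _ _ = (λ _ → zero , zero) , λ { {zero} {zero} _ → refl }
  rainbow (suc (suc l))  α β α-inj β-inj = extend (rainbow (suc l) row col row-inj col-inj)
    where open Cross α β α-inj β-inj (lastCell α β)

thin-lower : ∀ {m n N k l} → l ≤ m → l ≤ n → ThinAtMost N (Rook m n) k → l ≤ k
thin-lower {l = l} l≤m l≤n (ord , c , consistent) =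
  FP.injective⇒≤ (proj₂ (rainbow l (λ i → F.inject≤ i l≤m) (λ j → F.inject≤ j l≤n)
                                   (FP.inject≤-injective l≤m l≤m _ _)
                                   (FP.inject≤-injective l≤n l≤n _ _)))
  where open LowerBound ord c consistent

lemma4p25 : (n : ℕ) → 1 ≤ n →
    ThinEq {V = Fin n × Fin n} (n * n) (□-Adj (K-Adj n) (K-Adj n)) n
lemma4p25 n _ = thin-upper n n , λ k → thin-lower ℕ.≤-refl ℕ.≤-refl
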